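{- For every pattern $A$, every pathset $\mathcal{A}\in\mathcal{P}_A$ and every sub-pattern $A'\preceq A$, $\bar\chi_{A'}(\mathrm{proj}_{V_{A'}}(\mathcal{A}))\le\bar\chi_A(\mathcal{A})$.
   Context: Integers $n\ge1$, $k\ge2$; logs base 2. $V_k=\{v_0,\dots,v_k\}$, $E_k=\{v_iv_{i+1}:0\le i<k\}$. Pattern graph $G=(V_G,E_G)$: $E_G\subseteq E_k$, $V_G$ the endpoints of $E_G$; $c(G)$ = number of components. $[n]^V$ = maps $V\to[n]$; $x_S$ restriction; $yz$ combined tuple. For $\mathcal{A}\subseteq[n]^V$: $\mathrm{proj}_S(\mathcal{A})=\{x_S:x\in\mathcal{A}\}$; $\mu_S(\mathcal{A})=\max_{z\in[n]^{V\setminus S}}|\{y\in[n]^S:yz\in\mathcal{A}\}|/n^{|S|}$; join $\mathcal{A}\bowtie\mathcal{B}=\{x\in[n]^{V\cup W}:x_V\in\mathcal{A},x_W\in\mathcal{B}\}$. $\mathcal{P}_G$ = power set of $[n]^{V_G}$. $\varepsilon=1/\log k$, $\tilde n=n^{1-\varepsilon}$; $\mathcal{A}\in\mathcal{P}_G$ is $G$-small if $\mu_S(\mathcal{A})\le\tilde n^{ -t}$ for all $1\le t\le c(G)$ and all unions $S$ of $t$ components of $G$; $\mathcal{P}^{\mathrm{small}}_G$ the set of these. A pattern is the empty pattern $\emptyset$ or a rooted unordered binary tree (internal nodes with two children) with leaves labeled by elements of $E_k$; $G_A=(V_A,E_A)$ with $E_A$ the set of leaf labels; $\mathcal{P}_A=\mathcal{P}_{G_A}$;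 atomic = one leaf; $\{B,C\}$ = pattern whose root has subtrees $B,C$; a sub-pattern $A'\preceq A$ is the subtree of a node with all its descendants. $\bar\chi_\emptyset(\mathcal{A})=0$; $\bar\chi_A(\mathcal{A})=|\mathcal{A}|$ for atomic $A$; $\bar\chi_{\{B,C\}}(\mathcal{A})=\min\sum_i(\bar\chi_B(\mathcal{B}_i)+\bar\chi_C(\mathcal{C}_i))$ over finite sequences with $\mathcal{B}_i\in\mathcal{P}^{\mathrm{small}}_{G_B}$, $\mathcal{C}_i\in\mathcal{P}^{\mathrm{small}}_{G_C}$, $\mathcal{A}\subseteq\bigcup_i\mathcal{B}_i\bowtie\mathcal{C}_i$. -}

module Defs where

open import Data.Bool using (Bool; true; false; _∧_; _∨_; not; if_then_else_; T)
open import Data.Nat using (ℕ; zero; suc; _+_; _*_; _^_; _≤_; _<_)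
open import Data.Integer using (ℤ; +_; -[1+_])
open import Data.Fin using (Fin; toℕ; inject₁) renaming (zero to fz; suc to fs)
open import Data.Fin.Subset using (Subset; ⁅_⁆; _∪_; ∣_∣) renaming (⊥ to ∅ₛ)
open import Data.Vec using (Vec; []; _∷_; lookup; zipWith; replicate)
open import Data.List using (List; []; _∷_; _++_; map; concatMap)
open import Data.List.Relation.Unary.Any using (Any)
open import Data.Product using (_×_; _,_; Σ; ∃)
open import Data.Sum using (_⊎_)
open import Relation.Binary.PropositionalEquality using (_≡_)

-- Vertices v_0..v_k are Fin (suc k); edge i : Fin k is v_i v_{i+1}.
-- Vertex/edge sets are Subset (Vec Bool).

IsEnd : {k : ℕ} → Fin (suc k) → Fin k → Set
IsEnd v i = (v ≡ inject₁ i) ⊎ (v ≡ fs i)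

ShareVertex : {k : ℕ} → Fin k → Fin k → Set
ShareVertex {k} i j = ∃ λ (v : Fin (suc k)) → IsEnd v i × IsEnd v j

private
  orHead : {m : ℕ} → Bool → Vec Bool (suc m) → Vec Bool (suc m)
  orHead b (x ∷ xs) = (b ∨ x) ∷ xs

-- V_G: the set of endpoints of the edges in E  (v ∈ ends E iff some i ∈ E has IsEnd v i)
ends : {k : ℕ} → Subset k → Subset (suc k)
ends []      = false ∷ []
ends (b ∷ E) = b ∷ orHead b (ends E)

_∖_ : {m : ℕ} → Subset m → Subset m → Subset m
V ∖ S = zipWith (λ a b → a ∧ not b) V S

-- number of connected components of the graph with edge set F
-- (a subgraph of a path: components = maximal runs of consecutive edges,
--  counted by their first edges)
private
  runs : {k : ℕ} → Bool → Subset k → ℕ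
  runs prev []      = 0
  runs prev (b ∷ F) = (if b ∧ not prev then 1 else 0) + runs b F

comps : {k : ℕ} → Subset k → ℕ
comps F = runs false F

-- F ⊆ E is a union of components of the graph (ends E, E):
-- every edge of E sharing a vertex with an edge of F lies in F.
UnionOfComps : {k : ℕ} → Subset k → Subset k → Set
UnionOfComps {k} E F =
  (∀ (i : Fin k) → T (lookup F i) → T (lookup E i)) ×
  (∀ (i j : Fin k) → T (lookup E i) → T (lookup F j) → ShareVertex i j → T (lookup F i))

-- Tuples in [n]^S for S ⊆ V_k (canonical representation)

data Tup (n : ℕ) : {m : ℕ} → Subset m → Set where
  []   : Tup n []
  _∷ᵢ_ : {m : ℕ} {S : Subset m} → Fin n → Tup n S → Tup n (true ∷ S)
  ∷ₒ_  : {m : ℕ} {S : Subset m} → Tup n S → Tup n (false ∷ S)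

allFin : (n : ℕ) → List (Fin n)
allFin zero    = []
allFin (suc n) = fz ∷ map fs (allFin n)

allTup : {n m : ℕ} (S : Subset m) → List (Tup n S)
allTup {n} []          = [] ∷ []
allTup {n} (true ∷ S)  = concatMap (λ a → map (a ∷ᵢ_) (allTup S)) (allFin n)
allTup {n} (false ∷ S) = map ∷ₒ_ (allTup S)

private
  eqFin : {n : ℕ} → Fin n → Fin n → Bool
  eqFin fz     fz     = true
  eqFin fz     (fs _) = false
  eqFin (fs _) fz     = false
  eqFin (fs a) (fs b) = eqFin a b

-- agree y x : y and x coincide on the common coordinates S ∩ W.
-- For S ⊆ W this says exactly  x_S = y.
agree : {n m : ℕ} {S W : Subset m} → Tup n S → Tup n W → Bool
agree []        []        = true
agree (a ∷ᵢ y)  (b ∷ᵢ x)  = eqFin a b ∧ agree y x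
agree (a ∷ᵢ y)  (∷ₒ x)    = agree y x
agree (∷ₒ y)    (b ∷ᵢ x)  = agree y x
agree (∷ₒ y)    (∷ₒ x)    = agree y x

Pathset : (n : ℕ) {m : ℕ} → Subset m → Set
Pathset n S = Tup n S → Bool

anyL : {A : Set} → List A → (A → Bool) → Bool
anyL []       p = false
anyL (x ∷ xs) p = p x ∨ anyL xs p

countL : {A : Set} → List A → (A → Bool) → ℕ
countL []       p = 0
countL (x ∷ xs) p = (if p x then 1 else 0) + countL xs p

card : {n m : ℕ} {S : Subset m} → Pathset n S → ℕ
card {S = S} 𝒜 = countL (allTup S) 𝒜

_⊆ₚ_ : {n m : ℕ} {S : Subset m} → Pathset n S → Pathset n S → Set
_⊆ₚ_ {n} {S = S} 𝒜 ℬ = (x : Tup n S) → T (𝒜 x) → T (ℬ x)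

-- proj_W(𝒜) = { x_W : x ∈ 𝒜 }   (used with W ⊆ V)
proj : {n m : ℕ} {V : Subset m} (W : Subset m) → Pathset n V → Pathset n W
proj {V = V} W 𝒜 y = anyL (allTup V) (λ x → 𝒜 x ∧ agree y x)

-- 𝒜 ⋈ ℬ as a pathset on W = V ∪ U :  x_V ∈ 𝒜 and x_U ∈ ℬ
join : {n m : ℕ} {V U : Subset m} (W : Subset m) → Pathset n V → Pathset n U → Pathset n W
join {V = V} {U = U} W 𝒜 ℬ x =
  anyL (allTup V) (λ y → 𝒜 y ∧ agree y x) ∧ anyL (allTup U) (λ z → ℬ z ∧ agree z x)

-- numerator of μ_S(𝒜) at z ∈ [n]^{V∖S}:  |{ y ∈ [n]^S : yz ∈ 𝒜 }|
muCount : {n m : ℕ} {V : Subset m} (S : Subset m) → Pathset n V → Tup n (V ∖ S) → ℕ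
muCount {V = V} S 𝒜 z =
  countL (allTup S) (λ y → anyL (allTup V) (λ x → 𝒜 x ∧ agree y x ∧ agree z x))

-- The real inequality  a / n^s ≤ ñ^{-t},  ñ = n^{1-ε}, ε = 1/log k  (k ≥ 2),
-- i.e.  log k · log R ≤ t · log n  with  R = a·n^t / n^s,
-- expressed with integer arithmetic:  for every rational q = p/d (d ≥ 1),
--   q < log R   implies   q · log k < t · log n.

-- 2^(p/d) < R = a·n^t / n^s
QBelowLogR : (n a s t : ℕ) → ℤ → ℕ → Set
QBelowLogR n a s t (+ m)     d = 2 ^ m * (n ^ s) ^ d < (a * n ^ t) ^ d
QBelowLogR n a s t -[1+ m ]  d = (n ^ s) ^ d < (a * n ^ t) ^ d * 2 ^ suc m

-- k^(p/d) < n^t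
QBelowRhs : (n k t : ℕ) → ℤ → ℕ → Set
QBelowRhs n k t (+ m)    d = k ^ m < n ^ (t * d)
QBelowRhs n k t -[1+ m ] d = 1 < n ^ (t * d) * k ^ suc m

-- a / n^s ≤ ñ^{-t}
BoundOK : (n k s t a : ℕ) → Set
BoundOK n k s t a = (p : ℤ) (d : ℕ) → 1 ≤ d → QBelowLogR n a s t p d → QBelowRhs n k t p d

-- G-small, for G = (ends E, E):  for every union S of t ≥ 1 components
-- (S = vertex set of a union F of components, t = comps F),
-- μ_S(𝒜) = max_z muCount S 𝒜 z / n^|S|  ≤ ñ^{-t}.
Small : {n k : ℕ} (E : Subset k) → Pathset n (ends E) → Set
Small {n} {k} E 𝒜 =
  (F : Subset k) → UnionOfComps E F → 1 ≤ comps F →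
  (z : Tup n (ends E ∖ ends F)) →
  BoundOK n k ∣ ends F ∣ (comps F) (muCount (ends F) 𝒜 z)

data Tree (k : ℕ) : Set where
  leaf : Fin k → Tree k
  node : Tree k → Tree k → Tree k

data Pattern (k : ℕ) : Set where
  emptyP : Pattern k
  tree   : Tree k → Pattern k

Eₜ : {k : ℕ} → Tree k → Subset k
Eₜ (leaf e)   = ⁅ e ⁆
Eₜ (node B C) = Eₜ B ∪ Eₜ C

Vₜ : {k : ℕ} → Tree k → Subset (suc k)
Vₜ A = ends (Eₜ A)

Eₚ : {k : ℕ} → Pattern k → Subset k
Eₚ emptyP   = ∅ₛ
Eₚ (tree A) = Eₜ A

Vₚ : {k : ℕ} → Pattern k → Subset (suc k)
Vₚ A = ends (Eₚ A)

data _⪯ₜ_ {k : ℕ} : Tree k → Tree k → Set where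
  here  : {A : Tree k} → A ⪯ₜ A
  left  : {A B C : Tree k} → A ⪯ₜ B → A ⪯ₜ node B C
  right : {A B C : Tree k} → A ⪯ₜ C → A ⪯ₜ node B C

data _⪯_ {k : ℕ} : Pattern k → Pattern k → Set where
  sub : {A B : Tree k} → A ⪯ₜ B → tree A ⪯ tree B

-- χ̄.  Since χ̄ is a minimum of natural numbers, we define the predicate
-- "χ̄_A(𝒜) ≤ m"  (ChiLe A 𝒜 m): some admissible cover has cost ≤ m.

mutual
  data ChiLe {n k : ℕ} : (A : Tree k) → Pathset n (Vₜ A) → ℕ → Set where
    leafLe : {e : Fin k} {𝒜 : Pathset n (Vₜ (leaf e))} {m : ℕ} →
             card 𝒜 ≤ m → ChiLe (leaf e) 𝒜 m
    nodeLe : {B C : Tree k} {𝒜 : Pathset n (Vₜ (node B C))} {m m' : ℕ}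
             (ps : List (Pathset n (Vₜ B) × Pathset n (Vₜ C))) →
             Covers B C ps m' →
             ((x : Tup n (Vₜ (node B C))) → T (𝒜 x) →
               Any (λ { (𝓑 , 𝓒) → T (join (Vₜ (node B C)) 𝓑 𝓒 x) }) ps) →
             m' ≤ m → ChiLe (node B C) 𝒜 m

  data Covers {n k : ℕ} (B C : Tree k) :
         List (Pathset n (Vₜ B) × Pathset n (Vₜ C)) → ℕ → Set where
    nil  : Covers B C [] 0
    cons : {𝓑 : Pathset n (Vₜ B)} {𝓒 : Pathset n (Vₜ C)} {b c m : ℕ}
           {ps : List (Pathset n (Vₜ B) × Pathset n (Vₜ C))} →
           Small (Eₜ B) 𝓑 → Small (Eₜ C) 𝓒 →
           ChiLe B 𝓑 b → ChiLe C 𝓒 c → Covers B C ps m →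
           Covers B C ((𝓑 , 𝓒) ∷ ps) (b + c + m)

ChiLeP : {n k : ℕ} (A : Pattern k) → Pathset n (Vₚ A) → ℕ → Set
ChiLeP emptyP   𝒜 m = 0 ≤ m
ChiLeP (tree A) 𝒜 m = ChiLe A 𝒜 m

{-# OPTIONS --safe #-}
-- If the root of A is {B, C} and 𝒜 ⊆ ⋃ᵢ 𝓑ᵢ ⋈ 𝓒ᵢ, then proj_{V_B}(𝒜) ⊆ ⋃ᵢ 𝓑ᵢ.
-- Since χ̄_B is monotone and subadditive, χ̄_B(proj_{V_B} 𝒜) ≤ Σᵢ χ̄_B(𝓑ᵢ), which
-- is at most the cost of the cover; likewise for C.  Projections compose, so
-- walking down from A to A' proves the claim.
module Submission where

open import Defs
open import Data.Bool using (Bool; true; false; _∧_; _∨_; if_then_else_; T)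
open import Data.Bool.Properties using (T-∧; T-∨)
open import Data.Empty using (⊥-elim)
open import Data.Fin using (Fin) renaming (zero to fz; suc to fs)
open import Data.Fin.Subset using (Subset; _∪_)
open import Data.List using (List; []; _∷_; _++_; map)
open import Data.List.Membership.Propositional using (find; lose)
open import Data.List.Relation.Unary.Any using (Any; here; there)
import Data.List.Relation.Unary.Any as Any
open import Data.List.Relation.Unary.Any.Properties using (map⁺; ++⁺ˡ; ++⁺ʳ)
open import Data.Nat using (ℕ; _≤_; _+_; z≤n; s≤s)
open import Data.Nat.Properties
  using (+-commutativeSemigroup; ≤-refl; ≤-trans; ≤-reflexive; +-mono-≤; +-monoˡ-≤; +-assoc; m≤m+n; m≤n+m)
open import Algebra.Properties.CommutativeSemigroup +-commutativeSemigroup using (interchange)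
open import Data.Product using (_×_; _,_; ∃; proj₁; proj₂)
open import Data.Sum using (inj₁; inj₂; [_,_]′)
open import Data.Unit using (tt)
open import Data.Vec using ([]; _∷_)
open import Function using (_∘_)
open import Function.Bundles using (Equivalence)
open import Relation.Binary.PropositionalEquality using (_≡_; refl; cong; subst; sym)

open Equivalence using (to; from)

private
  variable
    n k m : ℕ
    X : Set

anyL⁺ : {xs : List X} {p : X → Bool} → Any (T ∘ p) xs → T (anyL xs p)
anyL⁺ (here px)   = from T-∨ (inj₁ px)
anyL⁺ (there pxs) = from T-∨ (inj₂ (anyL⁺ pxs))

anyL⁻ : (xs : List X) {p : X → Bool} → T (anyL xs p) → Any (T ∘ p) xs
anyL⁻ (x ∷ xs) h = [ here , there ∘ anyL⁻ xs ]′ (to T-∨ h)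

anyL-∧⁻ : (xs : List X) (p q : X → Bool) →
          T (anyL xs (λ x → p x ∧ q x)) → ∃ λ x → T (p x) × T (q x)
anyL-∧⁻ xs p q h = let x , pq = Any.satisfied (anyL⁻ xs h) in x , to T-∧ pq

𝟙 : Bool → ℕ
𝟙 b = if b then 1 else 0

𝟙-mono : {a b : Bool} → (T a → T b) → 𝟙 a ≤ 𝟙 b
𝟙-mono {false} f = z≤n
𝟙-mono {true} {true} f = ≤-refl
𝟙-mono {true} {false} f = ⊥-elim (f tt)

𝟙-∨ : (a b : Bool) → 𝟙 (a ∨ b) ≤ 𝟙 a + 𝟙 b
𝟙-∨ true  b     = s≤s z≤n
𝟙-∨ false true  = ≤-refl
𝟙-∨ false false = z≤n

countL-mono : (xs : List X) {p q : X → Bool} →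
              (∀ x → T (p x) → T (q x)) → countL xs p ≤ countL xs q
countL-mono []       f = z≤n
countL-mono (x ∷ xs) f = +-mono-≤ (𝟙-mono (f x)) (countL-mono xs f)

countL-∨ : (xs : List X) (p q : X → Bool) →
           countL xs (λ x → p x ∨ q x) ≤ countL xs p + countL xs q
countL-∨ []       p q = z≤n
countL-∨ (x ∷ xs) p q = ≤-trans
  (+-mono-≤ (𝟙-∨ (p x) (q x)) (countL-∨ xs p q))
  (≤-reflexive (interchange (𝟙 (p x)) (𝟙 (q x)) (countL xs p) (countL xs q)))

countL-false : (xs : List X) → countL xs (λ _ → false) ≡ 0
countL-false []       = refl
countL-false (x ∷ xs) = countL-false xs

ChiLe-≤ : (A : Tree k) {𝒜 : Pathset n (Vₜ A)} {m m′ : ℕ} → ChiLe A 𝒜 m → m ≤ m′ → ChiLe A 𝒜 m′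
ChiLe-≤ (leaf e)   (leafLe |𝒜|≤m)           m≤m′ = leafLe (≤-trans |𝒜|≤m m≤m′)
ChiLe-≤ (node B C) (nodeLe ps cv cov cost≤m) m≤m′ = nodeLe ps cv cov (≤-trans cost≤m m≤m′)

ChiLe-⊆ : (A : Tree k) {𝒳 𝒜 : Pathset n (Vₜ A)} {m : ℕ} → 𝒳 ⊆ₚ 𝒜 → ChiLe A 𝒜 m → ChiLe A 𝒳 m
ChiLe-⊆ (leaf e)   𝒳⊆𝒜 (leafLe |𝒜|≤m)           = leafLe (≤-trans (countL-mono (allTup _) 𝒳⊆𝒜) |𝒜|≤m)
ChiLe-⊆ (node B C) 𝒳⊆𝒜 (nodeLe ps cv cov cost≤m) = nodeLe ps cv (λ x → cov x ∘ 𝒳⊆𝒜 x) cost≤m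

ChiLe-∅ : (A : Tree k) → ChiLe {n} A (λ _ → false) 0
ChiLe-∅ {n = n} (leaf e) = leafLe (≤-reflexive (countL-false (allTup {n} (Vₜ (leaf e)))))
ChiLe-∅ (node B C)        = nodeLe [] nil (λ _ ()) z≤n

Covers-++ : {B C : Tree k} {ps qs : List (Pathset n (Vₜ B) × Pathset n (Vₜ C))} {a b : ℕ} →
            Covers B C ps a → Covers B C qs b → Covers B C (ps ++ qs) (a + b)
Covers-++ nil cv′ = cv′
Covers-++ {b = b′} (cons {b = b} {c = c} {m = m} 𝓑-small 𝓒-small χ𝓑 χ𝓒 cv) cv′ =
  subst (Covers _ _ _) (sym (+-assoc (b + c) m b′)) (cons 𝓑-small 𝓒-small χ𝓑 χ𝓒 (Covers-++ cv cv′))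

ChiLe-∪ : (A : Tree k) {𝒳 𝒴 : Pathset n (Vₜ A)} {a b : ℕ} →
          ChiLe A 𝒳 a → ChiLe A 𝒴 b → ChiLe A (λ x → 𝒳 x ∨ 𝒴 x) (a + b)
ChiLe-∪ (leaf e) {𝒳} {𝒴} (leafLe |𝒳|≤a) (leafLe |𝒴|≤b) =
  leafLe (≤-trans (countL-∨ (allTup _) 𝒳 𝒴) (+-mono-≤ |𝒳|≤a |𝒴|≤b))
ChiLe-∪ (node B C) (nodeLe ps cv cov cost≤a) (nodeLe qs cv′ cov′ cost′≤b) =
  nodeLe (ps ++ qs) (Covers-++ cv cv′)
         (λ x → [ ++⁺ˡ ∘ cov x , ++⁺ʳ ps ∘ cov′ x ]′ ∘ to T-∨)
         (+-mono-≤ cost≤a cost′≤b)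

⋃ : {S : Subset m} → List (Pathset n S) → Pathset n S
⋃ 𝒳s y = anyL 𝒳s (λ 𝒳 → 𝒳 y)

ChiLe-⋃ˡ : {B C : Tree k} {ps : List (Pathset n (Vₜ B) × Pathset n (Vₜ C))} {m : ℕ} →
           Covers B C ps m → ChiLe B (⋃ (map proj₁ ps)) m
ChiLe-⋃ˡ {B = B} nil = ChiLe-∅ B
ChiLe-⋃ˡ {B = B} (cons {b = b} {c = c} {m = m} _ _ χ𝓑 _ cv) =
  ChiLe-≤ B (ChiLe-∪ B χ𝓑 (ChiLe-⋃ˡ cv)) (+-monoˡ-≤ m (m≤m+n b c))

ChiLe-⋃ʳ : {B C : Tree k} {ps : List (Pathset n (Vₜ B) × Pathset n (Vₜ C))} {m : ℕ} →
           Covers B C ps m → ChiLe C (⋃ (map proj₂ ps)) m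
ChiLe-⋃ʳ {C = C} nil = ChiLe-∅ C
ChiLe-⋃ʳ {C = C} (cons {b = b} {c = c} {m = m} _ _ _ χ𝓒 cv) =
  ChiLe-≤ C (ChiLe-∪ C χ𝓒 (ChiLe-⋃ʳ cv)) (+-monoˡ-≤ m (m≤n+m c b))

-- Inclusion of subsets, inductive (unlike Data.Fin.Subset._⊆_) so that proofs about Tup can recurse along it.
infix 4 _⊑_
data _⊑_ : {m : ℕ} → Subset m → Subset m → Set where
  []   : [] ⊑ []
  keep : {S W : Subset m} → S ⊑ W → true ∷ S ⊑ true ∷ W
  skip : {S W : Subset m} {b : Bool} → S ⊑ W → false ∷ S ⊑ b ∷ W

⊑-refl : (S : Subset m) → S ⊑ S
⊑-refl []          = []
⊑-refl (true ∷ S)  = keep (⊑-refl S)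
⊑-refl (false ∷ S) = skip (⊑-refl S)

⊑-trans : {S W U : Subset m} → S ⊑ W → W ⊑ U → S ⊑ U
⊑-trans []       []       = []
⊑-trans (keep s) (keep w) = keep (⊑-trans s w)
⊑-trans (skip s) (keep w) = skip (⊑-trans s w)
⊑-trans (skip s) (skip w) = skip (⊑-trans s w)

⊑-∪ˡ : (S W : Subset m) → S ⊑ S ∪ W
⊑-∪ˡ []          []      = []
⊑-∪ˡ (true ∷ S)  (b ∷ W) = keep (⊑-∪ˡ S W)
⊑-∪ˡ (false ∷ S) (b ∷ W) = skip (⊑-∪ˡ S W)

⊑-∪ʳ : (S W : Subset m) → W ⊑ S ∪ W
⊑-∪ʳ []          []          = []
⊑-∪ʳ (true ∷ S)  (true ∷ W)  = keep (⊑-∪ʳ S W)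
⊑-∪ʳ (false ∷ S) (true ∷ W)  = keep (⊑-∪ʳ S W)
⊑-∪ʳ (b ∷ S)     (false ∷ W) = skip (⊑-∪ʳ S W)

⊑-tail : {a b : Bool} {S W : Subset m} → a ∷ S ⊑ b ∷ W → S ⊑ W
⊑-tail (keep s) = s
⊑-tail (skip s) = s

⊑-∨ʳ : (c : Bool) {a b : Bool} {S W : Subset m} → a ∷ S ⊑ b ∷ W → a ∷ S ⊑ (c ∨ b) ∷ W
⊑-∨ʳ true  (keep s) = keep s
⊑-∨ʳ true  (skip s) = skip s
⊑-∨ʳ false s        = s

-- ends (b ∷ E) ors b into the head of ends E, which is exposed by abstracting over ends E.
ends-mono : {E F : Subset k} → E ⊑ F → ends E ⊑ ends F
ends-mono [] = skip []
ends-mono (keep {S = E} {W = F} s) with ends E | ends F | ends-mono s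
... | _ ∷ _ | _ ∷ _ | r = keep (keep (⊑-tail r))
ends-mono (skip {S = E} {W = F} {b = b} s) with ends E | ends F | ends-mono s
... | _ ∷ _ | _ ∷ _ | r = skip (⊑-∨ʳ b r)

Vₜ-⊑ˡ : (B C : Tree k) → Vₜ B ⊑ Vₜ (node B C)
Vₜ-⊑ˡ B C = ends-mono (⊑-∪ˡ (Eₜ B) (Eₜ C))

Vₜ-⊑ʳ : (B C : Tree k) → Vₜ C ⊑ Vₜ (node B C)
Vₜ-⊑ʳ B C = ends-mono (⊑-∪ʳ (Eₜ B) (Eₜ C))

⪯ₜ⇒Vₜ-⊑ : {A′ A : Tree k} → A′ ⪯ₜ A → Vₜ A′ ⊑ Vₜ A
⪯ₜ⇒Vₜ-⊑ {A′ = A′} here = ⊑-refl (Vₜ A′)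
⪯ₜ⇒Vₜ-⊑ (left  {B = B} {C = C} p) = ⊑-trans (⪯ₜ⇒Vₜ-⊑ p) (Vₜ-⊑ˡ B C)
⪯ₜ⇒Vₜ-⊑ (right {B = B} {C = C} p) = ⊑-trans (⪯ₜ⇒Vₜ-⊑ p) (Vₜ-⊑ʳ B C)

-- Equality test on Fin n; the one in Defs is private, but agree on a single coordinate is it.
_==_ : Fin n → Fin n → Bool
a == b = agree {S = true ∷ []} {W = true ∷ []} (a ∷ᵢ []) (b ∷ᵢ [])

==⇒≡ : (a b : Fin n) → T (a == b) → a ≡ b
==⇒≡ fz     fz     _ = refl
==⇒≡ (fs a) (fs b) h = cong fs (==⇒≡ a b h)

==-refl : (a : Fin n) → T (a == a)
==-refl fz     = tt
==-refl (fs a) = ==-refl a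

agree-∷ᵢ⁻ : {S W : Subset m} (a b : Fin n) (y : Tup n S) (x : Tup n W) →
            T (agree (a ∷ᵢ y) (b ∷ᵢ x)) → a ≡ b × T (agree y x)
agree-∷ᵢ⁻ a b y x h = let a≈b , y~x = to T-∧ h in ==⇒≡ a b (from T-∧ (a≈b , tt)) , y~x

agree-∷ᵢ⁺ : {S W : Subset m} (a : Fin n) (y : Tup n S) (x : Tup n W) →
            T (agree y x) → T (agree (a ∷ᵢ y) (a ∷ᵢ x))
agree-∷ᵢ⁺ a y x y~x = from T-∧ (proj₁ (to T-∧ (==-refl a)) , y~x)

agree⇒≡ : {S : Subset m} (y x : Tup n S) → T (agree y x) → y ≡ x
agree⇒≡ []       []       _   = refl
agree⇒≡ (a ∷ᵢ y) (b ∷ᵢ x) y~x with agree-∷ᵢ⁻ a b y x y~x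
... | refl , y~x′ = cong (a ∷ᵢ_) (agree⇒≡ y x y~x′)
agree⇒≡ (∷ₒ y)   (∷ₒ x)   y~x = cong ∷ₒ_ (agree⇒≡ y x y~x)

agree-via : {S W U : Subset m} → S ⊑ W → W ⊑ U →
                 (y : Tup n S) (y′ : Tup n W) (x : Tup n U) →
                 T (agree y x) → T (agree y′ x) → T (agree y y′)
agree-via [] [] [] [] [] _ _ = tt
agree-via (keep s) (keep w) (a ∷ᵢ y) (b ∷ᵢ y′) (c ∷ᵢ x) y~x y′~x
  with agree-∷ᵢ⁻ a c y x y~x | agree-∷ᵢ⁻ b c y′ x y′~x
... | refl , y~x′ | refl , y′~x′ = agree-∷ᵢ⁺ a y y′ (agree-via s w y y′ x y~x′ y′~x′)
agree-via (skip s) (keep w) (∷ₒ y) (b ∷ᵢ y′) (c ∷ᵢ x) y~x y′~x =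
  agree-via s w y y′ x y~x (proj₂ (agree-∷ᵢ⁻ b c y′ x y′~x))
agree-via (skip s) (skip w) (∷ₒ y) (∷ₒ y′) (c ∷ᵢ x) y~x y′~x = agree-via s w y y′ x y~x y′~x
agree-via (skip s) (skip w) (∷ₒ y) (∷ₒ y′) (∷ₒ x)   y~x y′~x = agree-via s w y y′ x y~x y′~x

-- The witness form of 𝒫 ⊆ₚ proj S 𝒜; it avoids having to show that allTup lists every tuple.
infix 4 _⊆π_
_⊆π_ : {S W : Subset m} → Pathset n S → Pathset n W → Set
𝒫 ⊆π 𝒜 = ∀ y → T (𝒫 y) → ∃ λ x → T (𝒜 x) × T (agree y x)

proj-⊆π : {V : Subset m} (S : Subset m) (𝒜 : Pathset n V) → proj S 𝒜 ⊆π 𝒜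
proj-⊆π S 𝒜 y = anyL-∧⁻ (allTup _) 𝒜 (agree y)

⊆π⇒⊆ₚ : {S : Subset m} {𝒫 𝒜 : Pathset n S} → 𝒫 ⊆π 𝒜 → 𝒫 ⊆ₚ 𝒜
⊆π⇒⊆ₚ {𝒜 = 𝒜} 𝒫⊆π𝒜 y y∈𝒫 =
  let x , x∈𝒜 , y~x = 𝒫⊆π𝒜 y y∈𝒫 in subst (T ∘ 𝒜) (sym (agree⇒≡ y x y~x)) x∈𝒜

-- join W 𝒳 𝒴 x unfolds to x ∈↑ 𝒳 ∧ x ∈↑ 𝒴.
_∈↑_ : {W V : Subset m} → Tup n V → Pathset n W → Bool
x ∈↑ 𝒳 = anyL (allTup _) (λ y → 𝒳 y ∧ agree y x)

⊆π-⋃ : {S W V : Subset m} {𝒫 : Pathset n S} {𝒜 : Pathset n V} {𝒳s : List (Pathset n W)} →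
       S ⊑ W → W ⊑ V → 𝒫 ⊆π 𝒜 → (∀ x → T (𝒜 x) → Any (λ 𝒳 → T (x ∈↑ 𝒳)) 𝒳s) → 𝒫 ⊆π ⋃ 𝒳s
⊆π-⋃ s w 𝒫⊆π𝒜 𝒜⊆⋃↑ y y∈𝒫 =
  let x , x∈𝒜 , y~x    = 𝒫⊆π𝒜 y y∈𝒫
      𝒳 , 𝒳∈𝒳s , x∈↑𝒳 = find (𝒜⊆⋃↑ x x∈𝒜)
      y′ , y′∈𝒳 , y′~x = anyL-∧⁻ (allTup _) 𝒳 (λ y′ → agree y′ x) x∈↑𝒳
  in y′ , anyL⁺ (lose 𝒳∈𝒳s y′∈𝒳) , agree-via s w y y′ x y~x y′~x

ChiLe-⊆π : {A′ A : Tree k} → A′ ⪯ₜ A → {𝒫 : Pathset n (Vₜ A′)} {𝒜 : Pathset n (Vₜ A)} {m : ℕ} →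
           𝒫 ⊆π 𝒜 → ChiLe A 𝒜 m → ChiLe A′ 𝒫 m
ChiLe-⊆π {A = A} here 𝒫⊆π𝒜 χ𝒜 = ChiLe-⊆ A (⊆π⇒⊆ₚ 𝒫⊆π𝒜) χ𝒜
ChiLe-⊆π (left {B = B} {C = C} p) 𝒫⊆π𝒜 (nodeLe ps cv cov cost≤m) =
  ChiLe-⊆π p (⊆π-⋃ (⪯ₜ⇒Vₜ-⊑ p) (Vₜ-⊑ˡ B C) 𝒫⊆π𝒜 (λ x → map⁺ ∘ Any.map (proj₁ ∘ to T-∧) ∘ cov x))
             (ChiLe-≤ B (ChiLe-⋃ˡ cv) cost≤m)
ChiLe-⊆π (right {B = B} {C = C} p) 𝒫⊆π𝒜 (nodeLe ps cv cov cost≤m) =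
  ChiLe-⊆π p (⊆π-⋃ (⪯ₜ⇒Vₜ-⊑ p) (Vₜ-⊑ʳ B C) 𝒫⊆π𝒜 (λ x → map⁺ ∘ Any.map (proj₂ ∘ to T-∧) ∘ cov x))
             (ChiLe-≤ C (ChiLe-⋃ʳ cv) cost≤m)

lemma10p2 : {n k : ℕ} → 1 ≤ n → 2 ≤ k →
    (A : Pattern k) (𝒜 : Pathset n (Vₚ A)) (A' : Pattern k) → A' ⪯ A →
    (m : ℕ) → ChiLeP A 𝒜 m → ChiLeP A' (proj (Vₚ A') 𝒜) m
lemma10p2 _ _ (tree A) 𝒜 (tree A′) (sub p) m χ𝒜 = ChiLe-⊆π p (proj-⊆π (Vₜ A′) 𝒜) χ𝒜
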